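{- For any BLM instance $I=(S,\mathcal{F},k,c,p,B)$, the algorithm $\mathrm{ComputeDP}(I)$ returns the table $\mathrm{DP}_I$.
   Context: A family $\mathcal{F}\subseteq 2^S\setminus\{\emptyset\}$ on a finite set $S$ is laminar if for all $X,Y\in\mathcal{F}$ either $X\cap Y=\emptyset$, $X\subseteq Y$, or $Y\subseteq X$. For a laminar family $\mathcal{F}$ on $S$ and $k:\mathcal{F}\to\mathbb{N}_{>0}$, let $\mathcal{I}_{\mathcal{F},k}=\{A\subseteq S : |A\cap X|\leq k(X)\ \forall X\in\mathcal{F}\}$. A BLM instance is a tuple $I=(S,\mathcal{F},k,c,p,B)$ with $S$ finite, $\mathcal{F}$ a laminar family on $S$ with $S\in\mathcal{F}$, $k:\mathcal{F}\to\mathbb{N}_{>0}$, $c,p:S\to\mathbb{N}$, $B\in\mathbb{N}$. For $R\subseteq S$, $c(R)=\sum_{e\in R}c(e)$, $p(R)=\sum_{e\in R}p(e)$. Let $P_I=\{0,1,\ldots,|S|\cdot\max_{e\in S}p(e)\}$. The DP table of $I$ is $\mathrm{DP}_I:\{0,\ldots,|S|\}\times P_I\to\mathbb{N}\cup\{\infty\}$, $\mathrm{DP}_I(q,t)=\min\{c(Q): Q\in\mathcal{I}_{\mathcal{F},k},\ |Q|=q,\ p(Q)=t\}$ (minimum of an empty set is $\infty$), and $\mathrm{DP}_I(q,t)=\infty$ for $(q,t)$ outside this domain. A set $X\in\mathcal{F}\setminus\{S\}$ is maximal if it is not contained in any other set of $\mathcal{F}\setminus\{S\}$. For $G\subseteq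 S$ let $\mathcal{F}_{\subseteq G}=\{Y\in\mathcal{F}:Y\subseteq G\}$; for maximal $X$, $I\cap X=(X,\mathcal{F}_{\subseteq X},k,c,p,B)$ and $I\setminus X=(S\setminus X,\mathcal{F}_{\subseteq(S\setminus X)}\cup\{S\setminus X\},\bar{k},c,p,B)$ with $\bar{k}(Y)=k(Y)$ for $Y\in\mathcal{F}$ and $\bar{k}(S\setminus X)=k(S)$ if $S\setminus X\notin\mathcal{F}$. For $I$ with $\mathcal{F}=\{S\}$ and $|S|>1$, a partitioned-instance of $I$ is $(S,\{S_1,S_2,S\},\tilde{k},c,p,B)$ where $S_1,S_2$ partition $S$ into two nonempty sets and $\tilde{k}\equiv k(S)$. Algorithm $\mathrm{ComputeDP}(I)$: initialize a table $D(q,t)=\infty$ for all $q\in\{0,\ldots,|S|\}$, $t\in P_I$. If $|S|=1$, set $D(1,p(S))=c(S)$ and $D(0,0)=0$ and return $D$. Otherwise, if $|\mathcal{F}|=1$, return $\mathrm{ComputeDP}(\tilde{I})$ for a partitioned-instance $\tilde{I}$ of $I$. Otherwise, find a maximal set $X\in\mathcal{F}\setminus\{S\}$, recursively compute $D_1=\mathrm{ComputeDP}(I\cap X)$ and $D_2=\mathrm{ComputeDP}(I\setminus X)$ (with value $\infty$ outside their domains), and for every $q\in\{0,\ldots,|S|\}$, $t\in P_I$ set $D(q,t)=\min_{q_1,q_2,t_1,t_2\in\mathbb{N},\,q_1+q_2=q,\,t_1+t_2=t}\{D_1(q_1,t_1)+D_2(q_2,t_2)\}$ if $q\leq k(S)$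 and $D(q,t)=\infty$ otherwise; return $D$. -}

module Defs where

open import Data.Bool using (Bool; true; false; if_then_else_; _∧_; _∨_; T; not)
open import Data.Nat using (ℕ; zero; suc; _+_; _*_; _∸_; _≤_; _⊔_; _⊓_; _≡ᵇ_; _≤ᵇ_; _≟_)
open import Data.Fin using (Fin)
open import Data.Fin.Subset using (Subset; _∈_; _⊆_; _∩_; _─_; ∣_∣; Nonempty; Empty)
open import Data.Fin.Subset.Properties using (_⊆?_)
open import Data.List using (List; []; _∷_; map; foldr; allFin; upTo; concatMap)
open import Data.Nat.ListAction using (sum)
open import Data.Vec using (lookup)
open import Data.Vec.Properties using (≡-dec)
import Data.Bool.Properties as BoolP
open import Data.Product using (Σ; ∃; _×_; _,_)
open import Data.Sum using (_⊎_)
open import Relation.Nullary using (¬_)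
open import Relation.Nullary.Decidable using (⌊_⌋)
open import Relation.Binary.PropositionalEquality using (_≡_; _≢_)

data ℕ∞ : Set where
  fin : ℕ → ℕ∞
  ∞   : ℕ∞

infixl 6 _+∞_
_+∞_ : ℕ∞ → ℕ∞ → ℕ∞
fin a +∞ fin b = fin (a + b)
_     +∞ _     = ∞

min∞ : ℕ∞ → ℕ∞ → ℕ∞
min∞ (fin a) (fin b) = fin (a ⊓ b)
min∞ (fin a) ∞       = fin a
min∞ ∞       y       = y

_≤∞_ : ℕ∞ → ℕ∞ → Set
fin a ≤∞ fin b = a ≤ b
fin a ≤∞ ∞     = Data.Bool.T true
∞     ≤∞ fin b = Data.Bool.T false
∞     ≤∞ ∞     = Data.Bool.T true

minList : List ℕ∞ → ℕ∞
minList = foldr min∞ ∞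

-- v is the minimum of the (possibly empty) set of values P; min ∅ = ∞
IsMin : (ℕ∞ → Set) → ℕ∞ → Set
IsMin P v = P v × (∀ w → P w → v ≤∞ w)
          ⊎ (v ≡ ∞ × (∀ w → P w → w ≡ ∞))

module _ {n : ℕ} where

  _≟ₛ_ : (X Y : Subset n) → Data.Bool.Bool
  X ≟ₛ Y = ⌊ ≡-dec BoolP._≟_ X Y ⌋

  _⊆ᵇ_ : (X Y : Subset n) → Bool
  X ⊆ᵇ Y = ⌊ X ⊆? Y ⌋

  sumOver : Subset n → (Fin n → ℕ) → ℕ
  sumOver Q f = sum (map (λ i → if lookup Q i then f i else 0) (allFin n))

  maxOver : Subset n → (Fin n → ℕ) → ℕ
  maxOver Q f = foldr _⊔_ 0 (map (λ i → if lookup Q i then f i else 0) (allFin n))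

-- BLM instances.  The finite set S is a subset of a universe Fin n;
-- a family of subsets is given by its (decidable) characteristic function.

record Instance (n : ℕ) : Set where
  field
    S : Subset n
    F : Subset n → Bool
    k : Subset n → ℕ           -- only relevant on members of 𝓕
    c : Fin n → ℕ
    p : Fin n → ℕ
    B : ℕ

open Instance public

_∈𝓕_ : ∀ {n} → Subset n → Instance n → Set
X ∈𝓕 I = T (F I X)

Laminar : ∀ {n} → (Subset n → Bool) → Set
Laminar {n} 𝓕 = ∀ (X Y : Subset n) → T (𝓕 X) → T (𝓕 Y) →
  Empty (X ∩ Y) ⊎ X ⊆ Y ⊎ Y ⊆ X

IsBLM : ∀ {n} → Instance n → Set
IsBLM {n} I =
    (∀ (X : Subset n) → X ∈𝓕 I → Nonempty X × X ⊆ S I)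
  × Laminar (F I)
  × S I ∈𝓕 I
  × (∀ (X : Subset n) → X ∈𝓕 I → 1 ≤ k I X)

Independent : ∀ {n} → Instance n → Subset n → Set
Independent {n} I A = A ⊆ S I × (∀ (X : Subset n) → X ∈𝓕 I → ∣ A ∩ X ∣ ≤ k I X)

-- DP tables: total functions, with value ∞ outside the domain
-- {0,…,|S|} × P_I, where P_I = {0,…,|S|·max_{e∈S} p(e)}.

Table : Set
Table = ℕ → ℕ → ℕ∞

pmax : ∀ {n} → Instance n → ℕ
pmax I = ∣ S I ∣ * maxOver (S I) (p I)

inDomain : ∀ {n} → Instance n → ℕ → ℕ → Bool
inDomain I q t = (q ≤ᵇ ∣ S I ∣) ∧ (t ≤ᵇ pmax I)

IsDPValue : ∀ {n} → Instance n → ℕ → ℕ → ℕ∞ → Set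
IsDPValue I q t v with inDomain I q t
... | true  = IsMin (λ w → ∃ λ Q → Independent I Q × ∣ Q ∣ ≡ q
                                  × sumOver Q (p I) ≡ t × w ≡ fin (sumOver Q (c I))) v
... | false = v ≡ ∞

IsDPTable : ∀ {n} → Instance n → Table → Set
IsDPTable I D = ∀ q t → IsDPValue I q t (D q t)

_∩ᴵ_ : ∀ {n} → Instance n → Subset n → Instance n
I ∩ᴵ X = record { S = X ; F = λ Y → F I Y ∧ (Y ⊆ᵇ X) ; k = k I
                ; c = c I ; p = p I ; B = B I }

_∖ᴵ_ : ∀ {n} → Instance n → Subset n → Instance n
I ∖ᴵ X = record
  { S = R
  ; F = λ Y → (F I Y ∧ (Y ⊆ᵇ R)) ∨ (Y ≟ₛ R)
  ; k = λ Y → if F I Y then k I Y else (if Y ≟ₛ R then k I (S I) else k I Y)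
  ; c = c I ; p = p I ; B = B I }
  where R = S I ─ X

partitioned : ∀ {n} → Instance n → Subset n → Subset n → Instance n
partitioned I S₁ S₂ = record
  { S = S I
  ; F = λ Y → (Y ≟ₛ S₁) ∨ (Y ≟ₛ S₂) ∨ (Y ≟ₛ S I)
  ; k = λ _ → k I (S I)
  ; c = c I ; p = p I ; B = B I }

IsPartition : ∀ {n} → Subset n → Subset n → Subset n → Set
IsPartition {n} S S₁ S₂ = Nonempty S₁ × Nonempty S₂ × Empty (S₁ ∩ S₂)
  × (∀ (e : Fin n) → e ∈ S → e ∈ S₁ ⊎ e ∈ S₂)
  × S₁ ⊆ S × S₂ ⊆ S

baseTable : ∀ {n} → Instance n → Table
baseTable I q t =
  if (q ≡ᵇ 1) ∧ (t ≡ᵇ sumOver (S I) (p I)) then fin (sumOver (S I) (c I))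
  else (if (q ≡ᵇ 0) ∧ (t ≡ᵇ 0) then fin 0 else ∞)

convolve : Table → Table → ℕ → ℕ → ℕ∞
convolve D₁ D₂ q t =
  minList (concatMap (λ q₁ → map (λ t₁ → D₁ q₁ t₁ +∞ D₂ (q ∸ q₁) (t ∸ t₁))
                                 (upTo (suc t)))
                     (upTo (suc q)))

combineTable : ∀ {n} → Instance n → Table → Table → Table
combineTable I D₁ D₂ q t =
  if inDomain I q t ∧ (q ≤ᵇ k I (S I)) then convolve D₁ D₂ q t else ∞

-- ComputeDP(I) as a (nondeterministic) algorithm: ComputeDP I D means
-- that some run of ComputeDP on I (for some choice of partitions and
-- maximal sets) returns the table D.

data ComputeDP {n : ℕ} : Instance n → Table → Set where
  single : ∀ {I} → ∣ S I ∣ ≡ 1 → ComputeDP I (baseTable I)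
  split₁ : ∀ {I S₁ S₂ D} → ∣ S I ∣ ≢ 1
         → (∀ (X : Subset n) → X ∈𝓕 I → X ≡ S I)
         → IsPartition (S I) S₁ S₂
         → ComputeDP (partitioned I S₁ S₂) D
         → ComputeDP I D
  split₂ : ∀ {I X D₁ D₂} → ∣ S I ∣ ≢ 1
         → X ∈𝓕 I → X ≢ S I
         → (∀ (Y : Subset n) → Y ∈𝓕 I → Y ≢ S I → X ⊆ Y → Y ≡ X)
         → ComputeDP (I ∩ᴵ X) D₁
         → ComputeDP (I ∖ᴵ X) D₂
         → ComputeDP I (combineTable I D₁ D₂)

-- DP_I(q, t) is the minimum cost of a feasible set of size q and profit t; since every such (q, t)
-- lies in the domain of the table, it suffices to show that every run of ComputeDP returns the
-- table of these minima, by induction on the run.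
-- If 𝓕 = {S}, adding the two halves of a partition to 𝓕 with bound k(S) changes no independent set.
-- If X is maximal, Q ↦ (Q ∩ X, Q ∖ X) maps independent sets of I to pairs of independent sets of
-- I ∩ X and I ∖ X; conversely, by laminarity and maximality every member of 𝓕 other than S lies
-- in X or is disjoint from it, so the union of such a pair is independent in I once its size is
-- at most k(S). Hence the optimum is the min-plus convolution of the two tables, truncated at k(S).
-- A run exists because a maximal member can always be found and both parts have smaller ground sets.

module Submission where

open import Defs
open import Data.Bool using (true; false; if_then_else_; _∧_; _∨_; T)
open import Data.Bool.Properties using (T-∧; T-∨) renaming (_≟_ to _≟-Bool_)
open import Data.Vec.Properties using (≡-dec)
open import Data.Empty using (⊥-elim)
open import Data.Fin using (Fin; zero; suc)
open import Data.Fin.Subset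
  using (Subset; _∈_; _∉_; _⊆_; _∩_; _∪_; _─_; ∣_∣; ⁅_⁆; ⊥; Nonempty; Empty)
open import Data.Fin.Subset.Properties
  using ( drop-∷-⊆; drop-∷-Empty; x∈p∩q⁺; x∈p∩q⁻; x∈p∪q⁻; p⊆q⇒∣p∣≤∣q∣; p∩q⊆p; p∩q⊆q
        ; _⊆?_; ⊆-antisym; ⊆-refl; ⊆-reflexive; ⊆-trans; p─q⊆p; x∈p∧x∉q⇒x∈p─q; _∈?_; ⊥⊆; ∣⊥∣≡0
        ; Empty-unique; ∣p∩q∣≤∣p∣; nonempty?; anySubset?; x∈⁅x⁆; x∈⁅y⁆⇒x≡y; ∣⁅x⁆∣≡1
        ; p∩q≢∅⇒∣p─q∣<∣p∣; ∩-comm )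
open import Data.List using (List; []; _∷_; map; foldr; upTo; concatMap; tabulate; allFin)
open import Data.List.Properties using (map-tabulate)
open import Data.List.Membership.Propositional using (find; lose) renaming (_∈_ to _∈ˡ_)
open import Data.List.Membership.Propositional.Properties
  using (∈-map⁺; ∈-map⁻; ∈-concatMap⁺; ∈-concatMap⁻; ∈-upTo⁺; ∈-upTo⁻)
open import Data.List.Relation.Unary.Any using (here; there)
open import Data.Vec using ([]; _∷_; here; there; lookup)
open import Data.Nat using (ℕ; zero; suc; _+_; _*_; _∸_; _≤_; _<_; _⊔_; _≡ᵇ_; _≤ᵇ_; z≤n; s≤s)
open import Data.Nat.Properties
open import Data.Nat.ListAction using (sum)
open import Data.Product using (Σ; ∃; ∃₂; _×_; _,_; proj₁; proj₂)
open import Data.Sum using (_⊎_; inj₁; inj₂; [_,_]′)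
open import Data.Unit using (tt)
open import Function using (_∘_; id; _⇔_; mk⇔; Equivalence)
open import Relation.Nullary using (¬_; yes; no)
open import Relation.Nullary.Decidable using (toWitness; fromWitness; T?; ¬?; _×-dec_)
open import Relation.Binary.Definitions using (DecidableEquality)
open import Relation.Binary.PropositionalEquality
  using (_≡_; _≢_; refl; sym; trans; cong; cong₂; subst; subst₂; module ≡-Reasoning)

open Equivalence using (to; from)
open import Algebra.Properties.CommutativeSemigroup +-commutativeSemigroup using (x∙yz≈y∙xz)

-- Extended naturals

≤∞-refl : ∀ a → a ≤∞ a
≤∞-refl (fin a) = ≤-refl
≤∞-refl ∞       = tt

≤∞-trans : ∀ {a b c} → a ≤∞ b → b ≤∞ c → a ≤∞ c
≤∞-trans {fin a} {fin b} {fin c} a≤b b≤c = ≤-trans a≤b b≤c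
≤∞-trans {fin a} {fin b} {∞}     _   _   = tt
≤∞-trans {fin a} {∞}     {∞}     _   _   = tt
≤∞-trans {∞}     {∞}     {∞}     _   _   = tt

≤∞-∞ : ∀ a → a ≤∞ ∞
≤∞-∞ (fin a) = tt
≤∞-∞ ∞       = tt

∞≤∞⇒≡∞ : ∀ {a} → ∞ ≤∞ a → a ≡ ∞
∞≤∞⇒≡∞ {∞} _ = refl

+∞-zeroʳ : ∀ a → a +∞ ∞ ≡ ∞
+∞-zeroʳ (fin a) = refl
+∞-zeroʳ ∞       = refl

+∞-mono-≤∞-fin : ∀ {a b x y} → a ≤∞ fin x → b ≤∞ fin y → (a +∞ b) ≤∞ fin (x + y)
+∞-mono-≤∞-fin {fin a} {fin b} = +-mono-≤

min∞-≤ˡ : ∀ a b → min∞ a b ≤∞ a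
min∞-≤ˡ (fin a) (fin b) = m⊓n≤m a b
min∞-≤ˡ (fin a) ∞       = ≤-refl
min∞-≤ˡ ∞       b       = ≤∞-∞ b

min∞-≤ʳ : ∀ a b → min∞ a b ≤∞ b
min∞-≤ʳ (fin a) (fin b) = m⊓n≤n a b
min∞-≤ʳ (fin a) ∞       = tt
min∞-≤ʳ ∞       b       = ≤∞-refl b

min∞-sel : ∀ a b → min∞ a b ≡ a ⊎ min∞ a b ≡ b
min∞-sel (fin a) (fin b) with ⊓-sel a b
... | inj₁ eq = inj₁ (cong fin eq)
... | inj₂ eq = inj₂ (cong fin eq)
min∞-sel (fin a) ∞ = inj₁ refl
min∞-sel ∞       b = inj₂ refl

minList-≤ : ∀ {x} xs → x ∈ˡ xs → minList xs ≤∞ x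
minList-≤ (y ∷ xs) (here refl) = min∞-≤ˡ y (minList xs)
minList-≤ {x} (y ∷ xs) (there x∈xs) =
  ≤∞-trans {min∞ y (minList xs)} {minList xs} {x} (min∞-≤ʳ y (minList xs)) (minList-≤ xs x∈xs)

minList-∈⊎∞ : ∀ xs → minList xs ∈ˡ xs ⊎ minList xs ≡ ∞
minList-∈⊎∞ []       = inj₂ refl
minList-∈⊎∞ (y ∷ xs) with min∞-sel y (minList xs)
... | inj₁ eq = inj₁ (here eq)
... | inj₂ eq with minList-∈⊎∞ xs
...   | inj₁ m∈xs = inj₁ (there (subst (_∈ˡ xs) (sym eq) m∈xs))
...   | inj₂ m≡∞  = inj₂ (trans eq m≡∞)

module _ {P : ℕ∞ → Set} {v : ℕ∞} where

  isMin : (∀ w → P w → v ≤∞ w) → P v ⊎ v ≡ ∞ → IsMin P v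
  isMin lower (inj₁ Pv)   = inj₁ (Pv , lower)
  isMin lower (inj₂ refl) = inj₂ (refl , λ w Pw → ∞≤∞⇒≡∞ (lower w Pw))

  isMin-lowerBound : IsMin P v → ∀ w → P w → v ≤∞ w
  isMin-lowerBound (inj₁ (_ , lower))   = lower
  isMin-lowerBound (inj₂ (refl , all∞)) w Pw rewrite all∞ w Pw = tt

  isMin-attained : IsMin P v → P v ⊎ v ≡ ∞
  isMin-attained (inj₁ (Pv , _))  = inj₁ Pv
  isMin-attained (inj₂ (v≡∞ , _)) = inj₂ v≡∞

isMin-∞ : ∀ {P : ℕ∞ → Set} → (∀ w → ¬ P w) → IsMin P ∞
isMin-∞ ¬P = inj₂ (refl , λ w Pw → ⊥-elim (¬P w Pw))

isMin-if : ∀ {P : ℕ∞ → Set} {v} b → (T b → IsMin P v) → (∀ w → P w → T b) →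
           IsMin P (if b then v else ∞)
isMin-if true  minimum _      = minimum tt
isMin-if false _       forces = isMin-∞ forces

isMin-resp : ∀ {P P′ : ℕ∞ → Set} {v} → (∀ w → P w ⇔ P′ w) → IsMin P v → IsMin P′ v
isMin-resp P⇔P′ minimum =
  isMin (λ w P′w → isMin-lowerBound minimum w (from (P⇔P′ w) P′w))
        (Data.Sum.map (to (P⇔P′ _)) id (isMin-attained minimum))

-- Min-plus convolution

module _ (D₁ D₂ : Table) where

  private
    term : ℕ → ℕ → ℕ → ℕ → ℕ∞
    term q t q₁ t₁ = D₁ q₁ t₁ +∞ D₂ (q ∸ q₁) (t ∸ t₁)

    row : ℕ → ℕ → ℕ → List ℕ∞
    row q t q₁ = map (term q t q₁) (upTo (suc t))

  convolve-≤ : ∀ q₁ q₂ t₁ t₂ {w₁ w₂} → D₁ q₁ t₁ ≤∞ fin w₁ → D₂ q₂ t₂ ≤∞ fin w₂ →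
               convolve D₁ D₂ (q₁ + q₂) (t₁ + t₂) ≤∞ fin (w₁ + w₂)
  convolve-≤ q₁ q₂ t₁ t₂ {w₁} {w₂} bound₁ bound₂ =
    ≤∞-trans {convolve D₁ D₂ q t} {D₁ q₁ t₁ +∞ D₂ q₂ t₂} {fin (w₁ + w₂)}
      (subst (convolve D₁ D₂ q t ≤∞_)
             (cong₂ (λ q₂′ t₂′ → D₁ q₁ t₁ +∞ D₂ q₂′ t₂′) (m+n∸m≡n q₁ q₂) (m+n∸m≡n t₁ t₂))
             (minList-≤ _ (∈-concatMap⁺ (row q t)
                (lose (∈-upTo⁺ (s≤s (m≤m+n q₁ q₂))) (∈-map⁺ (term q t q₁) (∈-upTo⁺ (s≤s (m≤m+n t₁ t₂))))))))
      (+∞-mono-≤∞-fin {D₁ q₁ t₁} {D₂ q₂ t₂} bound₁ bound₂)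
    where q = q₁ + q₂
          t = t₁ + t₂

  convolve-attained : ∀ q t → convolve D₁ D₂ q t ≡ ∞ ⊎
    ∃₂ λ q₁ t₁ → q₁ ≤ q × t₁ ≤ t × convolve D₁ D₂ q t ≡ D₁ q₁ t₁ +∞ D₂ (q ∸ q₁) (t ∸ t₁)
  convolve-attained q t with minList-∈⊎∞ (concatMap (row q t) (upTo (suc q)))
  ... | inj₂ ≡∞ = inj₁ ≡∞
  ... | inj₁ ∈candidates with find (∈-concatMap⁻ (row q t) ∈candidates)
  ...   | q₁ , q₁∈ , ∈row with ∈-map⁻ (term q t q₁) ∈row
  ...     | t₁ , t₁∈ , eq = inj₂ (q₁ , t₁ , ≤-pred (∈-upTo⁻ q₁∈) , ≤-pred (∈-upTo⁻ t₁∈) , eq)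

-- Subsets

sumOverᵣ : ∀ {n} → Subset n → (Fin n → ℕ) → ℕ
sumOverᵣ []      f = 0
sumOverᵣ (b ∷ p) f = (if b then f zero else 0) + sumOverᵣ p (f ∘ suc)

maxOverᵣ : ∀ {n} → Subset n → (Fin n → ℕ) → ℕ
maxOverᵣ []      f = 0
maxOverᵣ (b ∷ p) f = (if b then f zero else 0) ⊔ maxOverᵣ p (f ∘ suc)

map-allFin-suc : ∀ {n} (g : Fin (suc n) → ℕ) →
                 map g (allFin (suc n)) ≡ g zero ∷ map (g ∘ suc) (allFin n)
map-allFin-suc g = cong (g zero ∷_) (trans (map-tabulate suc g) (sym (map-tabulate id (g ∘ suc))))

sumOver≡sumOverᵣ : ∀ {n} (p : Subset n) f → sumOver p f ≡ sumOverᵣ p f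
sumOver≡sumOverᵣ []      f = refl
sumOver≡sumOverᵣ (b ∷ p) f =
  trans (cong sum (map-allFin-suc (λ i → if lookup (b ∷ p) i then f i else 0)))
        (cong ((if b then f zero else 0) +_) (sumOver≡sumOverᵣ p (f ∘ suc)))

maxOver≡maxOverᵣ : ∀ {n} (p : Subset n) f → maxOver p f ≡ maxOverᵣ p f
maxOver≡maxOverᵣ []      f = refl
maxOver≡maxOverᵣ (b ∷ p) f =
  trans (cong (foldr _⊔_ 0) (map-allFin-suc (λ i → if lookup (b ∷ p) i then f i else 0)))
        (cong ((if b then f zero else 0) ⊔_) (maxOver≡maxOverᵣ p (f ∘ suc)))

∣p∣≡sumOverᵣ-1 : ∀ {n} (p : Subset n) → ∣ p ∣ ≡ sumOverᵣ p (λ _ → 1)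
∣p∣≡sumOverᵣ-1 []          = refl
∣p∣≡sumOverᵣ-1 (true  ∷ p) = cong suc (∣p∣≡sumOverᵣ-1 p)
∣p∣≡sumOverᵣ-1 (false ∷ p) = ∣p∣≡sumOverᵣ-1 p

sumOverᵣ-⊥ : ∀ n f → sumOverᵣ (⊥ {n}) f ≡ 0
sumOverᵣ-⊥ zero    f = refl
sumOverᵣ-⊥ (suc n) f = sumOverᵣ-⊥ n (f ∘ suc)

sumOverᵣ-split : ∀ {n} (p q : Subset n) f → sumOverᵣ p f ≡ sumOverᵣ (p ∩ q) f + sumOverᵣ (p ─ q) f
sumOverᵣ-split []          []          f = refl
sumOverᵣ-split (true  ∷ p) (true  ∷ q) f =
  trans (cong (f zero +_) (sumOverᵣ-split p q (f ∘ suc))) (sym (+-assoc (f zero) _ _))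
sumOverᵣ-split (true  ∷ p) (false ∷ q) f =
  trans (cong (f zero +_) (sumOverᵣ-split p q (f ∘ suc)))
        (x∙yz≈y∙xz (f zero) (sumOverᵣ (p ∩ q) (f ∘ suc)) (sumOverᵣ (p ─ q) (f ∘ suc)))
sumOverᵣ-split (false ∷ p) (true  ∷ q) f = sumOverᵣ-split p q (f ∘ suc)
sumOverᵣ-split (false ∷ p) (false ∷ q) f = sumOverᵣ-split p q (f ∘ suc)

sumOverᵣ-∪ : ∀ {n} (p q : Subset n) f → Empty (p ∩ q) →
             sumOverᵣ (p ∪ q) f ≡ sumOverᵣ p f + sumOverᵣ q f
sumOverᵣ-∪ []          []          f _        = refl
sumOverᵣ-∪ (true  ∷ p) (true  ∷ q) f disjoint = ⊥-elim (disjoint (zero , here))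
sumOverᵣ-∪ (true  ∷ p) (false ∷ q) f disjoint =
  trans (cong (f zero +_) (sumOverᵣ-∪ p q (f ∘ suc) (drop-∷-Empty disjoint))) (sym (+-assoc (f zero) _ _))
sumOverᵣ-∪ (false ∷ p) (true  ∷ q) f disjoint =
  trans (cong (f zero +_) (sumOverᵣ-∪ p q (f ∘ suc) (drop-∷-Empty disjoint)))
        (x∙yz≈y∙xz (f zero) (sumOverᵣ p (f ∘ suc)) (sumOverᵣ q (f ∘ suc)))
sumOverᵣ-∪ (false ∷ p) (false ∷ q) f disjoint = sumOverᵣ-∪ p q (f ∘ suc) (drop-∷-Empty disjoint)

sumOverᵣ≤∣p∣*maxOverᵣ : ∀ {n} {p q : Subset n} f → p ⊆ q → sumOverᵣ p f ≤ ∣ p ∣ * maxOverᵣ q f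
sumOverᵣ≤∣p∣*maxOverᵣ {p = []}        {[]}        f _   = z≤n
sumOverᵣ≤∣p∣*maxOverᵣ {p = true  ∷ p} {true  ∷ q} f p⊆q =
  +-mono-≤ (m≤m⊔n (f zero) _)
           (≤-trans (sumOverᵣ≤∣p∣*maxOverᵣ (f ∘ suc) (drop-∷-⊆ p⊆q)) (*-monoʳ-≤ ∣ p ∣ (m≤n⊔m (f zero) _)))
sumOverᵣ≤∣p∣*maxOverᵣ {p = true  ∷ p} {false ∷ q} f p⊆q with p⊆q here
... | ()
sumOverᵣ≤∣p∣*maxOverᵣ {p = false ∷ p} {true  ∷ q} f p⊆q =
  ≤-trans (sumOverᵣ≤∣p∣*maxOverᵣ (f ∘ suc) (drop-∷-⊆ p⊆q)) (*-monoʳ-≤ ∣ p ∣ (m≤n⊔m (f zero) _))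
sumOverᵣ≤∣p∣*maxOverᵣ {p = false ∷ p} {false ∷ q} f p⊆q = sumOverᵣ≤∣p∣*maxOverᵣ (f ∘ suc) (drop-∷-⊆ p⊆q)

sumOver-⊥ : ∀ {n} f → sumOver (⊥ {n}) f ≡ 0
sumOver-⊥ {n} f = trans (sumOver≡sumOverᵣ ⊥ f) (sumOverᵣ-⊥ n f)

sumOver-split : ∀ {n} (p q : Subset n) f → sumOver p f ≡ sumOver (p ∩ q) f + sumOver (p ─ q) f
sumOver-split p q f
  rewrite sumOver≡sumOverᵣ p f | sumOver≡sumOverᵣ (p ∩ q) f | sumOver≡sumOverᵣ (p ─ q) f
  = sumOverᵣ-split p q f

sumOver-∪ : ∀ {n} (p q : Subset n) f → Empty (p ∩ q) → sumOver (p ∪ q) f ≡ sumOver p f + sumOver q f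
sumOver-∪ p q f
  rewrite sumOver≡sumOverᵣ (p ∪ q) f | sumOver≡sumOverᵣ p f | sumOver≡sumOverᵣ q f
  = sumOverᵣ-∪ p q f

sumOver≤∣q∣*maxOver : ∀ {n} {p q : Subset n} f → p ⊆ q → sumOver p f ≤ ∣ q ∣ * maxOver q f
sumOver≤∣q∣*maxOver {p = p} {q} f p⊆q rewrite sumOver≡sumOverᵣ p f | maxOver≡maxOverᵣ q f =
  ≤-trans (sumOverᵣ≤∣p∣*maxOverᵣ f p⊆q) (*-monoˡ-≤ (maxOverᵣ q f) (p⊆q⇒∣p∣≤∣q∣ p⊆q))

∣p∣≡∣p∩q∣+∣p─q∣ : ∀ {n} (p q : Subset n) → ∣ p ∣ ≡ ∣ p ∩ q ∣ + ∣ p ─ q ∣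
∣p∣≡∣p∩q∣+∣p─q∣ p q
  rewrite ∣p∣≡sumOverᵣ-1 p | ∣p∣≡sumOverᵣ-1 (p ∩ q) | ∣p∣≡sumOverᵣ-1 (p ─ q)
  = sumOverᵣ-split p q _

∣p∪q∣≡∣p∣+∣q∣ : ∀ {n} (p q : Subset n) → Empty (p ∩ q) → ∣ p ∪ q ∣ ≡ ∣ p ∣ + ∣ q ∣
∣p∪q∣≡∣p∣+∣q∣ p q
  rewrite ∣p∣≡sumOverᵣ-1 (p ∪ q) | ∣p∣≡sumOverᵣ-1 p | ∣p∣≡sumOverᵣ-1 q
  = sumOverᵣ-∪ p q _

∣p∣≡0⇒Empty : ∀ {n} (p : Subset n) → ∣ p ∣ ≡ 0 → Empty p
∣p∣≡0⇒Empty (true  ∷ p) ()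
∣p∣≡0⇒Empty (false ∷ p) _     (zero  , ())
∣p∣≡0⇒Empty (false ∷ p) ∣p∣≡0 (suc x , there x∈p) = ∣p∣≡0⇒Empty p ∣p∣≡0 (x , x∈p)

sumOver-∣p∣≡0 : ∀ {n} (p : Subset n) f → ∣ p ∣ ≡ 0 → sumOver p f ≡ 0
sumOver-∣p∣≡0 p f ∣p∣≡0 rewrite Empty-unique (∣p∣≡0⇒Empty p ∣p∣≡0) = sumOver-⊥ f

x∈p─q⇒x∉q : ∀ {n} (p q : Subset n) {x} → x ∈ p ─ q → x ∉ q
x∈p─q⇒x∉q (_ ∷ p) (true  ∷ q) {zero}  ()
x∈p─q⇒x∉q (_ ∷ p) (false ∷ q) {zero}  _            ()
x∈p─q⇒x∉q (_ ∷ p) (_     ∷ q) {suc x} (there x∈p─q) (there x∈q) = x∈p─q⇒x∉q p q x∈p─q x∈q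

Empty[p─q]⇒p⊆q : ∀ {n} {p q : Subset n} → Empty (p ─ q) → p ⊆ q
Empty[p─q]⇒p⊆q {q = q} empty {x} x∈p with x ∈? q
... | yes x∈q = x∈q
... | no  x∉q = ⊥-elim (empty (x , x∈p∧x∉q⇒x∈p─q x∈p x∉q))

p⊆q∧∣p∣≡∣q∣⇒p≡q : ∀ {n} {p q : Subset n} → p ⊆ q → ∣ p ∣ ≡ ∣ q ∣ → p ≡ q
p⊆q∧∣p∣≡∣q∣⇒p≡q {p = p} {q} p⊆q ∣p∣≡∣q∣ = ⊆-antisym p⊆q (Empty[p─q]⇒p⊆q (∣p∣≡0⇒Empty (q ─ p) ∣q─p∣≡0))
  where
  ∣q∩p∣≡∣q∣ : ∣ q ∩ p ∣ ≡ ∣ q ∣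
  ∣q∩p∣≡∣q∣ = ≤-antisym (∣p∩q∣≤∣p∣ q p)
                (subst (_≤ ∣ q ∩ p ∣) ∣p∣≡∣q∣ (p⊆q⇒∣p∣≤∣q∣ (λ x∈p → x∈p∩q⁺ (p⊆q x∈p , x∈p))))

  ∣q─p∣≡0 : ∣ q ─ p ∣ ≡ 0
  ∣q─p∣≡0 = +-cancelˡ-≡ ∣ q ∩ p ∣ _ 0 (begin
    ∣ q ∩ p ∣ + ∣ q ─ p ∣  ≡⟨ ∣p∣≡∣p∩q∣+∣p─q∣ q p ⟨
    ∣ q ∣                  ≡⟨ ∣q∩p∣≡∣q∣ ⟨
    ∣ q ∩ p ∣              ≡⟨ +-identityʳ _ ⟨
    ∣ q ∩ p ∣ + 0          ∎)
    where open ≡-Reasoning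

p⊆q∧p≢q⇒∣p∣<∣q∣ : ∀ {n} {p q : Subset n} → p ⊆ q → p ≢ q → ∣ p ∣ < ∣ q ∣
p⊆q∧p≢q⇒∣p∣<∣q∣ p⊆q p≢q = ≤∧≢⇒< (p⊆q⇒∣p∣≤∣q∣ p⊆q) (p≢q ∘ p⊆q∧∣p∣≡∣q∣⇒p≡q p⊆q)

Empty-⊆ : ∀ {n} {p p′ q q′ : Subset n} → p ⊆ p′ → q ⊆ q′ → Empty (p′ ∩ q′) → Empty (p ∩ q)
Empty-⊆ {p = p} {q = q} p⊆p′ q⊆q′ empty (x , x∈p∩q) with x∈p∩q⁻ p q x∈p∩q
... | x∈p , x∈q = empty (x , x∈p∩q⁺ (p⊆p′ x∈p , q⊆q′ x∈q))

Empty[p─q∩q] : ∀ {n} (p q : Subset n) → Empty ((p ─ q) ∩ q)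
Empty[p─q∩q] p q (x , x∈) with x∈p∩q⁻ (p ─ q) q x∈
... | x∈p─q , x∈q = x∈p─q⇒x∉q p q x∈p─q x∈q

[p∪q]∩r⊆p∩r : ∀ {n} {p q r : Subset n} → Empty (q ∩ r) → (p ∪ q) ∩ r ⊆ p ∩ r
[p∪q]∩r⊆p∩r {p = p} {q} {r} empty {x} x∈ with x∈p∩q⁻ (p ∪ q) r x∈
... | x∈p∪q , x∈r with x∈p∪q⁻ p q x∈p∪q
...   | inj₁ x∈p = x∈p∩q⁺ (x∈p , x∈r)
...   | inj₂ x∈q = ⊥-elim (empty (x , x∈p∩q⁺ (x∈q , x∈r)))

∩-monoˡ-⊆ : ∀ {n} {p p′ q : Subset n} → p ⊆ p′ → p ∩ q ⊆ p′ ∩ q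
∩-monoˡ-⊆ {p = p} {q = q} p⊆p′ x∈p∩q with x∈p∩q⁻ p q x∈p∩q
... | x∈p , x∈q = x∈p∩q⁺ (p⊆p′ x∈p , x∈q)

─-monoˡ-⊆ : ∀ {n} {p p′ q : Subset n} → p ⊆ p′ → p ─ q ⊆ p′ ─ q
─-monoˡ-⊆ {p = p} {q = q} p⊆p′ x∈p─q = x∈p∧x∉q⇒x∈p─q (p⊆p′ (p─q⊆p p q x∈p─q)) (x∈p─q⇒x∉q p q x∈p─q)

[p∪q]∩r⊆q∩r : ∀ {n} {p q r : Subset n} → Empty (p ∩ r) → (p ∪ q) ∩ r ⊆ q ∩ r
[p∪q]∩r⊆q∩r {p = p} {q} {r} empty {x} x∈ with x∈p∩q⁻ (p ∪ q) r x∈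
... | x∈p∪q , x∈r with x∈p∪q⁻ p q x∈p∪q
...   | inj₁ x∈p = ⊥-elim (empty (x , x∈p∩q⁺ (x∈p , x∈r)))
...   | inj₂ x∈q = x∈p∩q⁺ (x∈q , x∈r)

Empty[q∩[p─q]] : ∀ {n} (p q : Subset n) → Empty (q ∩ (p ─ q))
Empty[q∩[p─q]] p q = subst Empty (∩-comm (p ─ q) q) (Empty[p─q∩q] p q)

Empty[p∩q]∧p⊆r⇒p⊆r─q : ∀ {n} {p q r : Subset n} → Empty (p ∩ q) → p ⊆ r → p ⊆ r ─ q
Empty[p∩q]∧p⊆r⇒p⊆r─q {q = q} empty p⊆r {x} x∈p with x ∈? q
... | yes x∈q = ⊥-elim (empty (x , x∈p∩q⁺ (x∈p , x∈q)))
... | no  x∉q = x∈p∧x∉q⇒x∈p─q (p⊆r x∈p) x∉q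

_≟ˢ_ : ∀ {n} → DecidableEquality (Subset n)
_≟ˢ_ = ≡-dec _≟-Bool_

≟ₛ⇒≡ : ∀ {n} {X Y : Subset n} → T (X ≟ₛ Y) → X ≡ Y
≟ₛ⇒≡ = toWitness

≟ₛ-refl : ∀ {n} (X : Subset n) → T (X ≟ₛ X)
≟ₛ-refl X = fromWitness refl

⊆ᵇ⇒⊆ : ∀ {n} {X Y : Subset n} → T (X ⊆ᵇ Y) → X ⊆ Y
⊆ᵇ⇒⊆ = toWitness

⊆⇒⊆ᵇ : ∀ {n} {X Y : Subset n} → X ⊆ Y → T (X ⊆ᵇ Y)
⊆⇒⊆ᵇ = fromWitness

-- Feasible sets and optimal tables

module BLM {n} {I : Instance n} (blm : IsBLM I) where

  member⇒Nonempty : ∀ {X} → X ∈𝓕 I → Nonempty X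
  member⇒Nonempty X∈𝓕 = proj₁ (proj₁ blm _ X∈𝓕)

  member⇒⊆S : ∀ {X} → X ∈𝓕 I → X ⊆ S I
  member⇒⊆S X∈𝓕 = proj₂ (proj₁ blm _ X∈𝓕)

  laminar : Laminar (F I)
  laminar = proj₁ (proj₂ blm)

  S∈𝓕 : S I ∈𝓕 I
  S∈𝓕 = proj₁ (proj₂ (proj₂ blm))

  k-positive : ∀ {X} → X ∈𝓕 I → 1 ≤ k I X
  k-positive = proj₂ (proj₂ (proj₂ blm)) _

module _ {n} (I : Instance n) where

  FeasibleCost : ℕ → ℕ → ℕ∞ → Set
  FeasibleCost q t w = ∃ λ Q → Independent I Q × ∣ Q ∣ ≡ q
                             × sumOver Q (p I) ≡ t × w ≡ fin (sumOver Q (c I))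

  Optimal : Table → Set
  Optimal D = ∀ q t → IsMin (FeasibleCost q t) (D q t)

  ⊥-independent : Independent I ⊥
  ⊥-independent = ⊥⊆ , λ X _ → ≤-trans (∣p∩q∣≤∣p∣ ⊥ X) (≤-trans (≤-reflexive (∣⊥∣≡0 n)) z≤n)

  independent⇒∣Q∣≤k[S] : S I ∈𝓕 I → ∀ {Q} → Independent I Q → ∣ Q ∣ ≤ k I (S I)
  independent⇒∣Q∣≤k[S] S∈𝓕 {Q} (Q⊆S , bounded) =
    ≤-trans (p⊆q⇒∣p∣≤∣q∣ (λ x∈Q → x∈p∩q⁺ (x∈Q , Q⊆S x∈Q))) (bounded (S I) S∈𝓕)

  feasible⇒inDomain : ∀ {q t w} → FeasibleCost q t w → T (inDomain I q t)
  feasible⇒inDomain (Q , (Q⊆S , _) , refl , refl , _) =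
    from T-∧ (≤⇒≤ᵇ (p⊆q⇒∣p∣≤∣q∣ Q⊆S) , ≤⇒≤ᵇ (sumOver≤∣q∣*maxOver (p I) Q⊆S))

  optimal⇒IsDPTable : ∀ {D} → Optimal D → IsDPTable I D
  optimal⇒IsDPTable optimal q t with inDomain I q t in eq | isMin-attained (optimal q t)
  ... | true  | _              = optimal q t
  ... | false | inj₁ feasible = ⊥-elim (subst T eq (feasible⇒inDomain feasible))
  ... | false | inj₂ D[q,t]≡∞ = D[q,t]≡∞

-- Stated for a record update because partitioned I S₁ S₂ is definitionally one.
optimal-resp-independent :
  ∀ {n} {I : Instance n} {F′ k′ D} →
  (∀ Q → Independent (record I { F = F′ ; k = k′ }) Q ⇔ Independent I Q) →
  Optimal (record I { F = F′ ; k = k′ }) D → Optimal I D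
optimal-resp-independent same optimal q t =
  isMin-resp (λ w → mk⇔ (λ { (Q , ind , rest) → Q , to (same Q) ind , rest })
                        (λ { (Q , ind , rest) → Q , from (same Q) ind , rest }))
             (optimal q t)

-- The cases of ComputeDP

module _ {n} {I : Instance n} (blm : IsBLM I) (∣S∣≡1 : ∣ S I ∣ ≡ 1) where
  open BLM {I = I} blm

  S-independent : Independent I (S I)
  S-independent = ⊆-refl , λ X X∈𝓕 →
    ≤-trans (∣p∩q∣≤∣p∣ (S I) X) (subst (_≤ k I X) (sym ∣S∣≡1) (k-positive X∈𝓕))

  independent-∣Q∣≡1⇒Q≡S : ∀ {Q} → Independent I Q → ∣ Q ∣ ≡ 1 → Q ≡ S I
  independent-∣Q∣≡1⇒Q≡S (Q⊆S , _) ∣Q∣≡1 = p⊆q∧∣p∣≡∣q∣⇒p≡q Q⊆S (trans ∣Q∣≡1 (sym ∣S∣≡1))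

  baseTable-optimal : Optimal I (baseTable I)
  baseTable-optimal zero zero =
    isMin (λ { _ (_ , _ , _ , _ , refl) → z≤n })
          (inj₁ (⊥ , ⊥-independent I , ∣⊥∣≡0 n , sumOver-⊥ (p I) , cong fin (sym (sumOver-⊥ (c I)))))
  baseTable-optimal zero (suc t) =
    isMin-∞ λ { _ (Q , _ , ∣Q∣≡0 , p[Q]≡1+t , _) → 0≢1+n (trans (sym (sumOver-∣p∣≡0 Q (p I) ∣Q∣≡0)) p[Q]≡1+t) }
  -- baseTable I 1 t reduces to  if t ≡ᵇ p(S) then fin c(S) else ∞.
  baseTable-optimal 1 t =
    isMin-if (t ≡ᵇ sumOver (S I) (p I))
      (λ t≡p[S] → isMin (λ { _ (Q , Q-ind , ∣Q∣≡1 , _ , refl) →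
                               ≤-reflexive (cong (λ Z → sumOver Z (c I)) (sym (independent-∣Q∣≡1⇒Q≡S Q-ind ∣Q∣≡1))) })
                        (inj₁ (S I , S-independent , ∣S∣≡1 , sym (≡ᵇ⇒≡ t _ t≡p[S]) , refl)))
      (λ { _ (Q , Q-ind , ∣Q∣≡1 , refl , _) →
             ≡⇒≡ᵇ _ _ (cong (λ Z → sumOver Z (p I)) (independent-∣Q∣≡1⇒Q≡S Q-ind ∣Q∣≡1)) })
  baseTable-optimal (suc (suc q)) t =
    isMin-∞ λ { _ (Q , (Q⊆S , _) , ∣Q∣≡2+q , _) →
      <⇒≱ (s≤s (s≤s z≤n)) (subst₂ _≤_ ∣Q∣≡2+q ∣S∣≡1 (p⊆q⇒∣p∣≤∣q∣ Q⊆S)) }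

∈𝓕-partitioned⁻ : ∀ {n} (I : Instance n) (S₁ S₂ Y : Subset n) →
                  Y ∈𝓕 partitioned I S₁ S₂ → Y ≡ S₁ ⊎ Y ≡ S₂ ⊎ Y ≡ S I
∈𝓕-partitioned⁻ I S₁ S₂ Y Y∈ = Data.Sum.map ≟ₛ⇒≡ (Data.Sum.map ≟ₛ⇒≡ ≟ₛ⇒≡ ∘ to T-∨) (to T-∨ Y∈)

module _ {n} {I : Instance n} {S₁ S₂ : Subset n}
         (blm : IsBLM I) (partition : IsPartition (S I) S₁ S₂) where
  open BLM {I = I} blm

  private
    I′ = partitioned I S₁ S₂

    S₁∩S₂-Empty : Empty (S₁ ∩ S₂)
    S₁∩S₂-Empty = proj₁ (proj₂ (proj₂ partition))

    S₁⊆S : S₁ ⊆ S I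
    S₁⊆S = proj₁ (proj₂ (proj₂ (proj₂ (proj₂ partition))))

    S₂⊆S : S₂ ⊆ S I
    S₂⊆S = proj₂ (proj₂ (proj₂ (proj₂ (proj₂ partition))))

    member⇒Nonempty×⊆S : ∀ Y → Y ∈𝓕 I′ → Nonempty Y × Y ⊆ S I
    member⇒Nonempty×⊆S Y Y∈ with ∈𝓕-partitioned⁻ I S₁ S₂ Y Y∈
    ... | inj₁ refl        = proj₁ partition , S₁⊆S
    ... | inj₂ (inj₁ refl) = proj₁ (proj₂ partition) , S₂⊆S
    ... | inj₂ (inj₂ refl) = member⇒Nonempty S∈𝓕 , ⊆-refl

    laminar′ : Laminar (F I′)
    laminar′ Y Z Y∈ Z∈ with ∈𝓕-partitioned⁻ I S₁ S₂ Y Y∈ | ∈𝓕-partitioned⁻ I S₁ S₂ Z Z∈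
    ... | inj₂ (inj₂ refl) | _                = inj₂ (inj₂ (proj₂ (member⇒Nonempty×⊆S Z Z∈)))
    ... | _                | inj₂ (inj₂ refl) = inj₂ (inj₁ (proj₂ (member⇒Nonempty×⊆S Y Y∈)))
    ... | inj₁ refl        | inj₁ refl        = inj₂ (inj₁ ⊆-refl)
    ... | inj₁ refl        | inj₂ (inj₁ refl) = inj₁ S₁∩S₂-Empty
    ... | inj₂ (inj₁ refl) | inj₁ refl        = inj₁ (subst Empty (∩-comm S₁ S₂) S₁∩S₂-Empty)
    ... | inj₂ (inj₁ refl) | inj₂ (inj₁ refl) = inj₂ (inj₁ ⊆-refl)

    S∈𝓕′ : S I ∈𝓕 I′
    S∈𝓕′ = from (T-∨ {S I ≟ₛ S₁}) (inj₂ (from (T-∨ {S I ≟ₛ S₂}) (inj₂ (≟ₛ-refl (S I)))))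

  partitioned-isBLM : IsBLM I′
  partitioned-isBLM = member⇒Nonempty×⊆S , laminar′ , S∈𝓕′ , λ _ _ → k-positive S∈𝓕

  partitioned-independent : (∀ X → X ∈𝓕 I → X ≡ S I) → ∀ Q → Independent I′ Q ⇔ Independent I Q
  partitioned-independent only-S Q = mk⇔
    (λ (Q⊆S , bounded) → Q⊆S , λ X X∈𝓕 →
       subst (λ Y → ∣ Q ∩ Y ∣ ≤ k I Y) (sym (only-S X X∈𝓕)) (bounded (S I) S∈𝓕′))
    (λ Q-ind → proj₁ Q-ind , λ Y _ → ≤-trans (∣p∩q∣≤∣p∣ Q Y) (independent⇒∣Q∣≤k[S] I S∈𝓕 Q-ind))

singleton-partition : ∀ {n} {S : Subset n} {e} → e ∈ S → ∣ S ∣ ≢ 1 → IsPartition S ⁅ e ⁆ (S ─ ⁅ e ⁆)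
singleton-partition {S = S} {e} e∈S ∣S∣≢1 =
  (e , x∈⁅x⁆ e) , S─e-Nonempty , Empty[q∩[p─q]] S ⁅ e ⁆ , cover , ⁅e⁆⊆S , p─q⊆p S ⁅ e ⁆
  where
  ⁅e⁆⊆S : ⁅ e ⁆ ⊆ S
  ⁅e⁆⊆S x∈⁅e⁆ = subst (_∈ S) (sym (x∈⁅y⁆⇒x≡y e x∈⁅e⁆)) e∈S

  S─e-Nonempty : Nonempty (S ─ ⁅ e ⁆)
  S─e-Nonempty with nonempty? (S ─ ⁅ e ⁆)
  ... | yes nonempty = nonempty
  ... | no  empty    = ⊥-elim (∣S∣≢1 (trans (cong ∣_∣ (⊆-antisym (Empty[p─q]⇒p⊆q empty) ⁅e⁆⊆S)) (∣⁅x⁆∣≡1 e)))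

  cover : ∀ x → x ∈ S → x ∈ ⁅ e ⁆ ⊎ x ∈ S ─ ⁅ e ⁆
  cover x x∈S with x ∈? ⁅ e ⁆
  ... | yes x∈⁅e⁆ = inj₁ x∈⁅e⁆
  ... | no  x∉⁅e⁆ = inj₂ (x∈p∧x∉q⇒x∈p─q x∈S x∉⁅e⁆)

Maximal : ∀ {n} → Instance n → Subset n → Set
Maximal {n} I X = ∀ (Y : Subset n) → Y ∈𝓕 I → Y ≢ S I → X ⊆ Y → Y ≡ X

maximal-above : ∀ {n} {I : Instance n} → IsBLM I → ∀ m {X} → ∣ S I ∣ ∸ ∣ X ∣ < m → X ∈𝓕 I → X ≢ S I →
                ∃ λ Y → Y ∈𝓕 I × Y ≢ S I × Maximal I Y
maximal-above blm zero () _ _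
maximal-above {I = I} blm (suc m) {X} bound X∈𝓕 X≢S
  with anySubset? (λ Y → T? (F I Y) ×-dec ¬? (Y ≟ˢ S I) ×-dec (X ⊆? Y) ×-dec ¬? (Y ≟ˢ X))
... | no none = X , X∈𝓕 , X≢S , maximal
  where
  maximal : Maximal I X
  maximal Y Y∈𝓕 Y≢S X⊆Y with Y ≟ˢ X
  ... | yes Y≡X = Y≡X
  ... | no  Y≢X = ⊥-elim (none (Y , Y∈𝓕 , Y≢S , X⊆Y , Y≢X))
... | yes (Y , Y∈𝓕 , Y≢S , X⊆Y , Y≢X) =
  maximal-above {I = I} blm m (<-≤-trans closer (≤-pred bound)) Y∈𝓕 Y≢S
  where
  closer : ∣ S I ∣ ∸ ∣ Y ∣ < ∣ S I ∣ ∸ ∣ X ∣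
  closer = ∸-monoʳ-< (p⊆q∧p≢q⇒∣p∣<∣q∣ X⊆Y (Y≢X ∘ sym)) (p⊆q⇒∣p∣≤∣q∣ (BLM.member⇒⊆S {I = I} blm Y∈𝓕))

module _ {n} (I : Instance n) (X : Subset n) where

  ∈𝓕-∩ᴵ : ∀ Y → Y ∈𝓕 (I ∩ᴵ X) ⇔ (Y ∈𝓕 I × Y ⊆ X)
  ∈𝓕-∩ᴵ Y = mk⇔ (λ Y∈ → Data.Product.map₂ ⊆ᵇ⇒⊆ (to (T-∧ {F I Y}) Y∈))
                (λ (Y∈𝓕 , Y⊆X) → from (T-∧ {F I Y}) (Y∈𝓕 , ⊆⇒⊆ᵇ Y⊆X))

  ∈𝓕-∖ᴵ⁺ : ∀ {Y} → Y ∈𝓕 I → Y ⊆ S I ─ X → Y ∈𝓕 (I ∖ᴵ X)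
  ∈𝓕-∖ᴵ⁺ {Y} Y∈𝓕 Y⊆S─X = from (T-∨ {F I Y ∧ (Y ⊆ᵇ (S I ─ X))}) (inj₁ (from (T-∧ {F I Y}) (Y∈𝓕 , ⊆⇒⊆ᵇ Y⊆S─X)))

  S─X∈𝓕-∖ᴵ : (S I ─ X) ∈𝓕 (I ∖ᴵ X)
  S─X∈𝓕-∖ᴵ = from (T-∨ {F I (S I ─ X) ∧ ((S I ─ X) ⊆ᵇ (S I ─ X))}) (inj₂ (≟ₛ-refl (S I ─ X)))

  k-∖ᴵ : ∀ {Y} → Y ∈𝓕 I → k (I ∖ᴵ X) Y ≡ k I Y
  k-∖ᴵ {Y} Y∈𝓕 with F I Y
  ... | true  = refl
  ... | false = ⊥-elim Y∈𝓕

  ∈𝓕-∖ᴵ⁻ : ∀ {Y} → Y ∈𝓕 (I ∖ᴵ X) →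
           (Y ∈𝓕 I × Y ⊆ S I ─ X) ⊎ (Y ≡ S I ─ X × k (I ∖ᴵ X) Y ≡ k I (S I))
  ∈𝓕-∖ᴵ⁻ {Y} Y∈ with F I Y
  ... | true  = inj₁ (tt , [ ⊆ᵇ⇒⊆ , ⊆-reflexive ∘ ≟ₛ⇒≡ ]′ (to (T-∨ {Y ⊆ᵇ (S I ─ X)}) Y∈))
  ... | false with Y ≟ₛ (S I ─ X) in eq
  ...   | true  = inj₂ (≟ₛ⇒≡ (subst T (sym eq) tt) , refl)
  ...   | false = ⊥-elim Y∈

  ∩ᴵ-independent : ∀ {Q} → Independent I Q → Independent (I ∩ᴵ X) (Q ∩ X)
  ∩ᴵ-independent {Q} (_ , bounded) =
    p∩q⊆q Q X , λ Y Y∈ → ≤-trans (p⊆q⇒∣p∣≤∣q∣ (∩-monoˡ-⊆ (p∩q⊆p Q X))) (bounded Y (proj₁ (to (∈𝓕-∩ᴵ Y) Y∈)))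

module _ {n} {I : Instance n} {X : Subset n} (blm : IsBLM I) (X∈𝓕 : X ∈𝓕 I) where
  open BLM {I = I} blm

  ∩ᴵ-isBLM : IsBLM (I ∩ᴵ X)
  ∩ᴵ-isBLM = (λ Y Y∈ → Data.Product.map₁ member⇒Nonempty (to (∈𝓕-∩ᴵ I X Y) Y∈))
           , (λ Y Z Y∈ Z∈ → laminar Y Z (proj₁ (to (∈𝓕-∩ᴵ I X Y) Y∈)) (proj₁ (to (∈𝓕-∩ᴵ I X Z) Z∈)))
           , from (∈𝓕-∩ᴵ I X X) (X∈𝓕 , ⊆-refl)
           , (λ Y Y∈ → k-positive (proj₁ (to (∈𝓕-∩ᴵ I X Y) Y∈)))

  ∖ᴵ-isBLM : X ≢ S I → IsBLM (I ∖ᴵ X)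
  ∖ᴵ-isBLM X≢S = member , laminar∖ , S─X∈𝓕-∖ᴵ I X , positive
    where
    S─X-Nonempty : Nonempty (S I ─ X)
    S─X-Nonempty with nonempty? (S I ─ X)
    ... | yes nonempty = nonempty
    ... | no  empty    = ⊥-elim (X≢S (⊆-antisym (member⇒⊆S X∈𝓕) (Empty[p─q]⇒p⊆q empty)))

    member : ∀ Y → Y ∈𝓕 (I ∖ᴵ X) → Nonempty Y × Y ⊆ S I ─ X
    member Y Y∈ with ∈𝓕-∖ᴵ⁻ I X Y∈
    ... | inj₁ (Y∈𝓕 , Y⊆S─X) = member⇒Nonempty Y∈𝓕 , Y⊆S─X
    ... | inj₂ (refl , _)     = S─X-Nonempty , ⊆-refl

    laminar∖ : Laminar (F (I ∖ᴵ X))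
    laminar∖ Y Z Y∈ Z∈ with ∈𝓕-∖ᴵ⁻ I X Y∈ | ∈𝓕-∖ᴵ⁻ I X Z∈
    ... | inj₁ (Y∈𝓕 , _) | inj₁ (Z∈𝓕 , _) = laminar Y Z Y∈𝓕 Z∈𝓕
    ... | inj₁ (_ , Y⊆)  | inj₂ (refl , _) = inj₂ (inj₁ Y⊆)
    ... | inj₂ (refl , _) | inj₁ (_ , Z⊆)  = inj₂ (inj₂ Z⊆)
    ... | inj₂ (refl , _) | inj₂ (refl , _) = inj₂ (inj₁ ⊆-refl)

    positive : ∀ Y → Y ∈𝓕 (I ∖ᴵ X) → 1 ≤ k (I ∖ᴵ X) Y
    positive Y Y∈ with ∈𝓕-∖ᴵ⁻ I X Y∈
    ... | inj₁ (Y∈𝓕 , _) = subst (1 ≤_) (sym (k-∖ᴵ I X Y∈𝓕)) (k-positive Y∈𝓕)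
    ... | inj₂ (_ , k≡)  = subst (1 ≤_) (sym k≡) (k-positive S∈𝓕)

  ∖ᴵ-independent : ∀ {Q} → Independent I Q → Independent (I ∖ᴵ X) (Q ─ X)
  ∖ᴵ-independent {Q} Q-ind@(Q⊆S , bounded) = ─-monoˡ-⊆ Q⊆S , bounded∖
    where
    bounded∖ : ∀ Y → Y ∈𝓕 (I ∖ᴵ X) → ∣ (Q ─ X) ∩ Y ∣ ≤ k (I ∖ᴵ X) Y
    bounded∖ Y Y∈ with ∈𝓕-∖ᴵ⁻ I X Y∈
    ... | inj₁ (Y∈𝓕 , _) = subst (∣ (Q ─ X) ∩ Y ∣ ≤_) (sym (k-∖ᴵ I X Y∈𝓕))
                             (≤-trans (p⊆q⇒∣p∣≤∣q∣ (∩-monoˡ-⊆ (p─q⊆p Q X))) (bounded Y Y∈𝓕))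
    ... | inj₂ (_ , k≡)  = subst (∣ (Q ─ X) ∩ Y ∣ ≤_) (sym k≡)
                             (≤-trans (p⊆q⇒∣p∣≤∣q∣ (⊆-trans (p∩q⊆p (Q ─ X) Y) (p─q⊆p Q X)))
                                      (independent⇒∣Q∣≤k[S] I S∈𝓕 Q-ind))

  -- Laminarity and maximality leave only sets inside X or outside X to check.
  ∪-independent : Maximal I X → ∀ {Q₁ Q₂} → Independent (I ∩ᴵ X) Q₁ → Independent (I ∖ᴵ X) Q₂ →
                  ∣ Q₁ ∣ + ∣ Q₂ ∣ ≤ k I (S I) → Independent I (Q₁ ∪ Q₂)
  ∪-independent maximal {Q₁} {Q₂} (Q₁⊆X , bounded₁) (Q₂⊆S─X , bounded₂) ∣Q₁∣+∣Q₂∣≤k =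
    ∪⊆S , bounded
    where
    Q₁∩Q₂-Empty : Empty (Q₁ ∩ Q₂)
    Q₁∩Q₂-Empty = Empty-⊆ Q₁⊆X Q₂⊆S─X (Empty[q∩[p─q]] (S I) X)

    ∪⊆S : Q₁ ∪ Q₂ ⊆ S I
    ∪⊆S x∈ = [ member⇒⊆S X∈𝓕 ∘ Q₁⊆X , p─q⊆p (S I) X ∘ Q₂⊆S─X ]′ (x∈p∪q⁻ Q₁ Q₂ x∈)

    inside : ∀ {Y} → Y ∈𝓕 I → Y ⊆ X → ∣ (Q₁ ∪ Q₂) ∩ Y ∣ ≤ k I Y
    inside {Y} Y∈𝓕 Y⊆X =
      ≤-trans (p⊆q⇒∣p∣≤∣q∣ ([p∪q]∩r⊆p∩r {p = Q₁} (Empty-⊆ Q₂⊆S─X Y⊆X (Empty[p─q∩q] (S I) X))))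
              (bounded₁ Y (from (∈𝓕-∩ᴵ I X Y) (Y∈𝓕 , Y⊆X)))

    outside : ∀ {Y} → Y ∈𝓕 I → Empty (Y ∩ X) → ∣ (Q₁ ∪ Q₂) ∩ Y ∣ ≤ k I Y
    outside {Y} Y∈𝓕 Y∩X-Empty =
      ≤-trans (p⊆q⇒∣p∣≤∣q∣ ([p∪q]∩r⊆q∩r {q = Q₂} (Empty-⊆ Q₁⊆X Y⊆S─X (Empty[q∩[p─q]] (S I) X))))
              (subst (∣ Q₂ ∩ Y ∣ ≤_) (k-∖ᴵ I X Y∈𝓕) (bounded₂ Y (∈𝓕-∖ᴵ⁺ I X Y∈𝓕 Y⊆S─X)))
      where Y⊆S─X = Empty[p∩q]∧p⊆r⇒p⊆r─q Y∩X-Empty (member⇒⊆S Y∈𝓕)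

    bounded : ∀ Y → Y ∈𝓕 I → ∣ (Q₁ ∪ Q₂) ∩ Y ∣ ≤ k I Y
    bounded Y Y∈𝓕 with Y ≟ˢ S I
    ... | yes refl = ≤-trans (∣p∩q∣≤∣p∣ (Q₁ ∪ Q₂) (S I))
                             (subst (_≤ k I (S I)) (sym (∣p∪q∣≡∣p∣+∣q∣ Q₁ Q₂ Q₁∩Q₂-Empty)) ∣Q₁∣+∣Q₂∣≤k)
    ... | no  Y≢S with laminar Y X Y∈𝓕 X∈𝓕
    ...   | inj₁ Y∩X-Empty   = outside Y∈𝓕 Y∩X-Empty
    ...   | inj₂ (inj₁ Y⊆X) = inside Y∈𝓕 Y⊆X
    ...   | inj₂ (inj₂ X⊆Y) = inside Y∈𝓕 (⊆-reflexive (maximal Y Y∈𝓕 Y≢S X⊆Y))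

  module _ (maximal : Maximal I X) {D₁ D₂ : Table}
           (optimal₁ : Optimal (I ∩ᴵ X) D₁) (optimal₂ : Optimal (I ∖ᴵ X) D₂) where

    feasible-∪ : ∀ {q₁ q₂ t₁ t₂ w₁ w₂} →
                 FeasibleCost (I ∩ᴵ X) q₁ t₁ w₁ → FeasibleCost (I ∖ᴵ X) q₂ t₂ w₂ → q₁ + q₂ ≤ k I (S I) →
                 FeasibleCost I (q₁ + q₂) (t₁ + t₂) (w₁ +∞ w₂)
    feasible-∪ (Q₁ , Q₁-ind , refl , refl , refl) (Q₂ , Q₂-ind , refl , refl , refl) ∣Q₁∣+∣Q₂∣≤k =
      Q₁ ∪ Q₂ , ∪-independent maximal Q₁-ind Q₂-ind ∣Q₁∣+∣Q₂∣≤k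
              , ∣p∪q∣≡∣p∣+∣q∣ Q₁ Q₂ disjoint
              , sumOver-∪ Q₁ Q₂ (p I) disjoint
              , cong fin (sym (sumOver-∪ Q₁ Q₂ (c I) disjoint))
      where disjoint = Empty-⊆ (proj₁ Q₁-ind) (proj₁ Q₂-ind) (Empty[q∩[p─q]] (S I) X)

    convolve-lowerBound : ∀ q t w → FeasibleCost I q t w → convolve D₁ D₂ q t ≤∞ w
    convolve-lowerBound _ _ _ (Q , Q-ind , refl , refl , refl)
      rewrite ∣p∣≡∣p∩q∣+∣p─q∣ Q X | sumOver-split Q X (p I) | sumOver-split Q X (c I) =
      convolve-≤ D₁ D₂ ∣ Q ∩ X ∣ ∣ Q ─ X ∣ (sumOver (Q ∩ X) (p I)) (sumOver (Q ─ X) (p I))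
        (isMin-lowerBound (optimal₁ _ _) _ (Q ∩ X , ∩ᴵ-independent I X Q-ind , refl , refl , refl))
        (isMin-lowerBound (optimal₂ _ _) _ (Q ─ X , ∖ᴵ-independent Q-ind , refl , refl , refl))

    convolve-feasible⊎∞ : ∀ q t → q ≤ k I (S I) →
                          FeasibleCost I q t (convolve D₁ D₂ q t) ⊎ convolve D₁ D₂ q t ≡ ∞
    convolve-feasible⊎∞ q t q≤k with convolve-attained D₁ D₂ q t
    ... | inj₁ ≡∞ = inj₂ ≡∞
    ... | inj₂ (q₁ , t₁ , q₁≤q , t₁≤t , eq)
        with isMin-attained (optimal₁ q₁ t₁) | isMin-attained (optimal₂ (q ∸ q₁) (t ∸ t₁))
    ...   | inj₂ ≡∞ | _ = inj₂ (trans eq (cong (_+∞ D₂ (q ∸ q₁) (t ∸ t₁)) ≡∞))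
    ...   | inj₁ _  | inj₂ ≡∞ = inj₂ (trans eq (trans (cong (D₁ q₁ t₁ +∞_) ≡∞) (+∞-zeroʳ (D₁ q₁ t₁))))
    ...   | inj₁ feasible₁ | inj₁ feasible₂ =
      inj₁ (subst (FeasibleCost I q t) (sym eq)
             (subst₂ (λ q′ t′ → FeasibleCost I q′ t′ (D₁ q₁ t₁ +∞ D₂ (q ∸ q₁) (t ∸ t₁)))
                     (m+[n∸m]≡n q₁≤q) (m+[n∸m]≡n t₁≤t)
               (feasible-∪ feasible₁ feasible₂ (subst (_≤ k I (S I)) (sym (m+[n∸m]≡n q₁≤q)) q≤k))))

    combineTable-optimal : Optimal I (combineTable I D₁ D₂)
    combineTable-optimal q t =
      isMin-if (inDomain I q t ∧ (q ≤ᵇ k I (S I)))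
        (λ within → isMin (convolve-lowerBound q t)
                          (convolve-feasible⊎∞ q t (≤ᵇ⇒≤ q _ (proj₂ (to (T-∧ {inDomain I q t}) within)))))
        (λ { w feasible@(Q , Q-ind , refl , _) →
               from T-∧ (feasible⇒inDomain I feasible , ≤⇒≤ᵇ (independent⇒∣Q∣≤k[S] I S∈𝓕 Q-ind)) })

-- Runs of ComputeDP

computeDP-optimal : ∀ {n} {I : Instance n} {D} → IsBLM I → ComputeDP I D → Optimal I D
computeDP-optimal {I = I} blm (single ∣S∣≡1) = baseTable-optimal {I = I} blm ∣S∣≡1
computeDP-optimal {I = I} blm (split₁ _ only-S partition run) =
  optimal-resp-independent {I = I} (partitioned-independent {I = I} blm partition only-S)
    (computeDP-optimal (partitioned-isBLM {I = I} blm partition) run)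
computeDP-optimal {I = I} blm (split₂ _ X∈𝓕 X≢S maximal run₁ run₂) =
  combineTable-optimal {I = I} blm X∈𝓕 maximal
    (computeDP-optimal (∩ᴵ-isBLM {I = I} blm X∈𝓕) run₁)
    (computeDP-optimal (∖ᴵ-isBLM {I = I} blm X∈𝓕 X≢S) run₂)

module _ {n} {I : Instance n}
         (recurse : ∀ {J : Instance n} → IsBLM J → ∣ S J ∣ < ∣ S I ∣ → Σ Table (ComputeDP J))
         (blm : IsBLM I) (∣S∣≢1 : ∣ S I ∣ ≢ 1) where
  open BLM {I = I} blm

  computeDP-split₂ : ∀ {X} → X ∈𝓕 I → X ≢ S I → Σ Table (ComputeDP I)
  computeDP-split₂ {X} X∈𝓕 X≢S with maximal-above {I = I} blm (suc (∣ S I ∣ ∸ ∣ X ∣)) ≤-refl X∈𝓕 X≢S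
  ... | Y , Y∈𝓕 , Y≢S , maximal =
    combineTable I (proj₁ run₁) (proj₁ run₂) , split₂ ∣S∣≢1 Y∈𝓕 Y≢S maximal (proj₂ run₁) (proj₂ run₂)
    where
    y,y∈Y = member⇒Nonempty Y∈𝓕
    run₁ = recurse (∩ᴵ-isBLM {I = I} blm Y∈𝓕) (p⊆q∧p≢q⇒∣p∣<∣q∣ (member⇒⊆S Y∈𝓕) Y≢S)
    run₂ = recurse (∖ᴵ-isBLM {I = I} blm Y∈𝓕 Y≢S)
             (p∩q≢∅⇒∣p─q∣<∣p∣ (S I) Y (proj₁ y,y∈Y , x∈p∩q⁺ (member⇒⊆S Y∈𝓕 (proj₂ y,y∈Y) , proj₂ y,y∈Y)))

module _ {n} {I : Instance n}
         (recurse : ∀ {J : Instance n} → IsBLM J → ∣ S J ∣ < ∣ S I ∣ → Σ Table (ComputeDP J))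
         (blm : IsBLM I) where
  open BLM {I = I} blm

  computeDP-step : Σ Table (ComputeDP I)
  computeDP-step with ∣ S I ∣ ≟ 1 | anySubset? (λ Y → T? (F I Y) ×-dec ¬? (Y ≟ˢ S I))
  ... | yes ∣S∣≡1 | _                   = baseTable I , single ∣S∣≡1
  ... | no  ∣S∣≢1 | yes (X , X∈𝓕 , X≢S) = computeDP-split₂ recurse blm ∣S∣≢1 X∈𝓕 X≢S
  ... | no  ∣S∣≢1 | no  only-S =
    proj₁ run , split₁ ∣S∣≢1 only-S′ partition (proj₂ run)
    where
    e,e∈S = member⇒Nonempty S∈𝓕
    e = proj₁ e,e∈S
    partition = singleton-partition (proj₂ e,e∈S) ∣S∣≢1

    only-S′ : ∀ X → X ∈𝓕 I → X ≡ S I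
    only-S′ X X∈𝓕 with X ≟ˢ S I
    ... | yes X≡S = X≡S
    ... | no  X≢S = ⊥-elim (only-S (X , X∈𝓕 , X≢S))

    run : Σ Table (ComputeDP (partitioned I ⁅ e ⁆ (S I ─ ⁅ e ⁆)))
    run = computeDP-split₂ recurse (partitioned-isBLM {I = I} blm partition) ∣S∣≢1 {⁅ e ⁆}
            (from (T-∨ {⁅ e ⁆ ≟ₛ ⁅ e ⁆} {(⁅ e ⁆ ≟ₛ (S I ─ ⁅ e ⁆)) ∨ (⁅ e ⁆ ≟ₛ S I)}) (inj₁ (≟ₛ-refl ⁅ e ⁆)))
            (λ ⁅e⁆≡S → ∣S∣≢1 (trans (cong ∣_∣ (sym ⁅e⁆≡S)) (∣⁅x⁆∣≡1 e)))

computeDP-total : ∀ {n} m {I : Instance n} → ∣ S I ∣ < m → IsBLM I → Σ Table (ComputeDP I)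
computeDP-total zero    ()
computeDP-total (suc m) ∣S∣<1+m blm =
  computeDP-step (λ blm′ smaller → computeDP-total m (<-≤-trans smaller (≤-pred ∣S∣<1+m)) blm′) blm

lemma3p8 : ∀ {n : ℕ} (I : Instance n) → IsBLM I →
    Σ Table (ComputeDP I) × (∀ (D : Table) → ComputeDP I D → IsDPTable I D)
lemma3p8 I blm =
  computeDP-total (suc ∣ S I ∣) ≤-refl blm , λ D run → optimal⇒IsDPTable I (computeDP-optimal blm run)
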